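{- Let $\mathcal{B}$ be a finite relational structure with domain $B$, let $b\in B$, and suppose the shop $\exists_b$ is a she of $\mathcal{B}$. Let $\varphi(u,\mathbf{v})$ be a formula of $\{\exists,\forall,\wedge,\vee\}$-FO with free variables among $u$ and $\mathbf{v}=(v_1,\dots,v_k)$. Then for all $\mathbf{x}\in B^k$, $\mathcal{B}\models\exists u\,\varphi(u,\mathbf{x})$ if and only if $\mathcal{B}\models\varphi(b,\mathbf{x})$.
   Context: $\{\exists,\forall,\wedge,\vee\}$-FO is the set of first-order formulas over the signature of $\mathcal{B}$ built from relational atoms using only $\wedge,\vee,\exists,\forall$ (no equality, no negation). A shop on $B$ is a map $f:B\to\mathfrak{P}(B)\setminus\{\emptyset\}$ with every $y\in B$ in some $f(x)$; a she of $\mathcal{B}$ is a shop $f$ such that for each relation $R$ of $\mathcal{B}$, $\mathcal{B}\models R(x_1,\dots,x_i)$ implies $\mathcal{B}\models R(y_1,\dots,y_i)$ for all $y_j\in f(x_j)$. The shop $\exists_b$ is defined by $\exists_b(x)=\{x,b\}$ for all $x\in B$. -}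

module Defs where

open import Data.Nat using (ℕ; suc)
open import Data.Fin using (Fin; zero; suc)
open import Data.Vec using (Vec; map)
open import Data.Vec.Functional using (_∷_)
open import Data.List using (List)
open import Data.Bool using (Bool; true)
open import Data.Product using (Σ; ∃; _×_; _,_)
open import Data.Sum using (_⊎_)
open import Relation.Binary.PropositionalEquality using (_≡_)
open import Relation.Unary using (Pred)
open import Data.Vec.Relation.Binary.Pointwise.Inductive using (Pointwise)

-- A relational signature: a list of arities (one per relation symbol).
Signature : Set
Signature = List ℕ

data Sym : Signature → ℕ → Set where
  here  : ∀ {a as} → Sym (a Data.List.∷ as) a
  there : ∀ {a b as} → Sym as a → Sym (b Data.List.∷ as) a

record Structure (σ : Signature) : Set where
  field
    size : ℕ
    rel  : ∀ {a} → Sym σ a → Vec (Fin size) a → Bool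

open Structure public

Dom : ∀ {σ} → Structure σ → Set
Dom 𝓑 = Fin (size 𝓑)

_⊨R_[_] : ∀ {σ a} (𝓑 : Structure σ) → Sym σ a → Vec (Dom 𝓑) a → Set
𝓑 ⊨R R [ xs ] = rel 𝓑 R xs ≡ true

-- {∃,∀,∧,∨}-FO formulas over σ with free variables among Fin m (de Bruijn).
-- Only relational atoms; no equality, no negation.
data Formula (σ : Signature) : ℕ → Set where
  atom : ∀ {m a} → Sym σ a → Vec (Fin m) a → Formula σ m
  _∧′_ : ∀ {m} → Formula σ m → Formula σ m → Formula σ m
  _∨′_ : ∀ {m} → Formula σ m → Formula σ m → Formula σ m
  ∃′   : ∀ {m} → Formula σ (suc m) → Formula σ m
  ∀′   : ∀ {m} → Formula σ (suc m) → Formula σ m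

_⊨_[_] : ∀ {σ m} (𝓑 : Structure σ) → Formula σ m → (Fin m → Dom 𝓑) → Set
𝓑 ⊨ atom R vs [ ρ ] = 𝓑 ⊨R R [ map ρ vs ]
𝓑 ⊨ φ ∧′ ψ [ ρ ] = (𝓑 ⊨ φ [ ρ ]) × (𝓑 ⊨ ψ [ ρ ])
𝓑 ⊨ φ ∨′ ψ [ ρ ] = (𝓑 ⊨ φ [ ρ ]) ⊎ (𝓑 ⊨ ψ [ ρ ])
𝓑 ⊨ ∃′ φ [ ρ ] = Σ (Dom 𝓑) λ x → 𝓑 ⊨ φ [ x ∷ ρ ]
𝓑 ⊨ ∀′ φ [ ρ ] = (x : Dom 𝓑) → 𝓑 ⊨ φ [ x ∷ ρ ]

-- A shop on B: a map f : B → P(B) \ {∅} that is surjective (every y lies in some f(x)).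
-- Subsets of B are represented as predicates.
ShopMap : Set → Set₁
ShopMap B = B → Pred B _

IsShop : ∀ {B : Set} → ShopMap B → Set
IsShop {B} f = ((x : B) → ∃ λ y → f x y) × ((y : B) → ∃ λ x → f x y)

IsShe : ∀ {σ} (𝓑 : Structure σ) → ShopMap (Dom 𝓑) → Set
IsShe {σ} 𝓑 f =
  IsShop f ×
  (∀ {a} (R : Sym σ a) (xs ys : Vec (Dom 𝓑) a) →
     𝓑 ⊨R R [ xs ] → Pointwise f xs ys → 𝓑 ⊨R R [ ys ])

∃-shop : ∀ {B : Set} → B → ShopMap B
∃-shop b x y = (y ≡ x) ⊎ (y ≡ b)

module Submission where

open import Defs
open import Data.Nat using (ℕ; suc)
open import Data.Fin using (Fin; zero; suc)
open import Data.Vec using (Vec; []; map) renaming (_∷_ to _∷ᵥ_)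
open import Data.Vec.Functional using (_∷_)
open import Data.Product using (_,_; proj₁; proj₂)
open import Data.Sum using (inj₁; inj₂)
open import Function.Bundles using (_⇔_; mk⇔)
open import Relation.Binary.PropositionalEquality using (refl)
open import Data.Vec.Relation.Binary.Pointwise.Inductive using (Pointwise; []) renaming (_∷_ to _∷ₚ_)

-- Positive formulas are preserved by any she f: if every variable is moved to an
-- element of its f-image, truth is preserved (the two shop conditions handle ∃ and ∀).
-- The she ∃_b may move any one variable to b, so a witness u of ∃u φ can be
-- replaced by b while the parameters stay fixed.

PointwiseImage : ∀ {B : Set} {m} → ShopMap B → (Fin m → B) → (Fin m → B) → Set
PointwiseImage f ρ ρ′ = ∀ i → f (ρ i) (ρ′ i)

module _ {B : Set} (f : ShopMap B) where

  PointwiseImage-map : ∀ {m a} {ρ ρ′ : Fin m → B} → PointwiseImage f ρ ρ′ →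
                       (vs : Vec (Fin m) a) → Pointwise f (map ρ vs) (map ρ′ vs)
  PointwiseImage-map r []         = []
  PointwiseImage-map r (v ∷ᵥ vs) = r v ∷ₚ PointwiseImage-map r vs

  PointwiseImage-∷ : ∀ {m} {ρ ρ′ : Fin m → B} {x y : B} → f x y →
                     PointwiseImage f ρ ρ′ → PointwiseImage f (x ∷ ρ) (y ∷ ρ′)
  PointwiseImage-∷ fxy r zero    = fxy
  PointwiseImage-∷ fxy r (suc i) = r i

module _ {σ : Signature} (𝓑 : Structure σ) {f : ShopMap (Dom 𝓑)} (she : IsShe 𝓑 f) where

  she-preserves-⊨ : ∀ {m} (φ : Formula σ m) {ρ ρ′ : Fin m → Dom 𝓑} →
                    PointwiseImage f ρ ρ′ → 𝓑 ⊨ φ [ ρ ] → 𝓑 ⊨ φ [ ρ′ ]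
  she-preserves-⊨ (atom R vs) r h = proj₂ she R _ _ h (PointwiseImage-map f r vs)
  she-preserves-⊨ (φ ∧′ ψ) r (h₁ , h₂) = she-preserves-⊨ φ r h₁ , she-preserves-⊨ ψ r h₂
  she-preserves-⊨ (φ ∨′ ψ) r (inj₁ h) = inj₁ (she-preserves-⊨ φ r h)
  she-preserves-⊨ (φ ∨′ ψ) r (inj₂ h) = inj₂ (she-preserves-⊨ ψ r h)
  she-preserves-⊨ (∃′ φ) r (x , h) =
    let y , fxy = proj₁ (proj₁ she) x in
    y , she-preserves-⊨ φ (PointwiseImage-∷ f fxy r) h
  she-preserves-⊨ (∀′ φ) r h y =
    let x , fxy = proj₂ (proj₁ she) y in
    she-preserves-⊨ φ (PointwiseImage-∷ f fxy r) (h x)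

∃-shop-replaces-head : ∀ {B : Set} {m} (b a : B) (ρ : Fin m → B) →
                       PointwiseImage (∃-shop b) (a ∷ ρ) (b ∷ ρ)
∃-shop-replaces-head b a ρ zero    = inj₂ refl
∃-shop-replaces-head b a ρ (suc i) = inj₁ refl

lemma3p2 : {σ : Signature} (𝓑 : Structure σ) (b : Dom 𝓑) →
    IsShe 𝓑 (∃-shop b) →
    {k : ℕ} (φ : Formula σ (suc k)) (x : Fin k → Dom 𝓑) →
    (𝓑 ⊨ ∃′ φ [ x ]) ⇔ (𝓑 ⊨ φ [ b ∷ x ])
lemma3p2 𝓑 b she φ x = mk⇔ witness-b (b ,_)
  where
  witness-b : 𝓑 ⊨ ∃′ φ [ x ] → 𝓑 ⊨ φ [ b ∷ x ]
  witness-b (a , h) = she-preserves-⊨ 𝓑 she φ (∃-shop-replaces-head b a x) h
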